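{- For every $n\ge1$ and every non-constant function $f\colon\{0,1\}^n\to\{ -1,1\}$ we have $\mathsf{D}_{\oplus}(f)\ge \mathsf{gran}(f)+1$.
   Context: For $S \subseteq [n]$ let $\chi_S(x)=\prod_{i\in S}(-1)^{x_i}$ and $\widehat{f}(S)=2^{ -n}\sum_{x\in\{0,1\}^n} f(x)\chi_S(x)$. For a rational $\alpha$ whose denominator is a power of $2$, $\mathsf{gran}(\alpha)$ is the minimal integer $k\ge0$ with $2^k\alpha\in\mathbb{Z}$; $\mathsf{gran}(f)=\max_{S\subseteq[n]}\mathsf{gran}(\widehat{f}(S))$. A parity decision tree is a rooted binary tree whose internal nodes are labeled by parities $\bigoplus_{i\in S}x_i$ ($S\subseteq[n]$), with two outgoing edges per internal node labeled by the possible values of the parity, and leaves labeled by $-1$ or $1$; on input $x$ one follows the edges consistent with $x$ and outputs the leaf label. $\mathsf{D}_{\oplus}(f)$ is the minimal depth of a parity decision tree computing $f$ on all inputs. -}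

module Defs where

open import Data.Bool using (Bool; true; false; if_then_else_)
open import Data.Nat as ℕ using (ℕ; zero; suc; _^_; _⊔_)
open import Data.Nat.Properties using (m^n≢0)
open import Data.Integer as ℤ using (ℤ; +_; -_)
open import Data.Rational as ℚ using (ℚ; _/_)
open import Data.Vec using (Vec; []; _∷_)
open import Data.List using (List; []; _∷_; map; _++_; foldr)
open import Data.Product using (∃; _×_)
open import Data.Empty using (⊥)
open import Data.Bool using (_xor_; _∧_)
open import Relation.Binary.PropositionalEquality using (_≡_)

-- The Boolean cube {0,1}^n, with false = 0 and true = 1.
Cube : ℕ → Set
Cube n = Vec Bool n

-- A subset S ⊆ [n], given by its indicator vector.
SubsetN : ℕ → Set
SubsetN n = Vec Bool n

data PM : Set where
  minusOne plusOne : PM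

PMtoℤ : PM → ℤ
PMtoℤ minusOne = - (+ 1)
PMtoℤ plusOne  = + 1

allCube : (n : ℕ) → List (Cube n)
allCube zero    = [] ∷ []
allCube (suc n) = map (false ∷_) (allCube n) ++ map (true ∷_) (allCube n)

sumℤ : List ℤ → ℤ
sumℤ = foldr ℤ._+_ (+ 0)

parity : ∀ {n} → SubsetN n → Cube n → Bool
parity []      []      = false
parity (s ∷ S) (b ∷ x) = (s ∧ b) xor parity S x

-- χ_S(x) = ∏_{i∈S} (-1)^{x_i} = (-1)^{⊕_{i∈S} x_i}.
χ : ∀ {n} → SubsetN n → Cube n → ℤ
χ S x = if parity S x then - (+ 1) else + 1

fourier : ∀ {n} → (Cube n → PM) → SubsetN n → ℚ
fourier {n} f S =
  _/_ (sumℤ (map (λ x → PMtoℤ (f x) ℤ.* χ S x) (allCube n))) (2 ^ n) {{m^n≢0 2 n}}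

IsInteger : ℚ → Set
IsInteger α = ∃ λ (z : ℤ) → α ≡ z / 1

IsGran : ℚ → ℕ → Set
IsGran α k =
  IsInteger ((+ (2 ^ k) / 1) ℚ.* α) ×
  (∀ j → j ℕ.< k → IsInteger ((+ (2 ^ j) / 1) ℚ.* α) → ⊥)

IsGranF : ∀ {n} → (Cube n → PM) → ℕ → Set
IsGranF {n} f g =
  (∃ λ (S : SubsetN n) → IsGran (fourier f S) g) ×
  (∀ (S : SubsetN n) (k : ℕ) → IsGran (fourier f S) k → k ℕ.≤ g)

data PDT (n : ℕ) : Set where
  leaf : PM → PDT n
  node : SubsetN n → PDT n → PDT n → PDT n

evalPDT : ∀ {n} → PDT n → Cube n → PM
evalPDT (leaf b)       x = b
evalPDT (node S t₀ t₁) x = if parity S x then evalPDT t₁ x else evalPDT t₀ x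

depth : ∀ {n} → PDT n → ℕ
depth (leaf _)       = 0
depth (node _ t₀ t₁) = suc (depth t₀ ⊔ depth t₁)

Computes : ∀ {n} → PDT n → (Cube n → PM) → Set
Computes T f = ∀ x → evalPDT T x ≡ f x

IsDPar : ∀ {n} → (Cube n → PM) → ℕ → Set
IsDPar {n} f d =
  (∃ λ (T : PDT n) → Computes T f × depth T ≡ d) ×
  (∀ (T : PDT n) → Computes T f → d ℕ.≤ depth T)

NonConstant : ∀ {n} → (Cube n → PM) → Set
NonConstant {n} f = ∃ λ (x : Cube n) → ∃ λ (y : Cube n) → f x ≡ f y → ⊥

-- A query of a parity R splits the cube by the indicators (1 ± χ_R)/2, and
-- χ_R χ_S = χ_{R △ S}; so each query at most doubles the denominators of the
-- Fourier coefficients, and any integer labelling of the leaves of a parity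
-- tree of depth d yields a function with coefficients in 2^{-d} ℤ.  Applied to
-- the 0/1-valued h = (f + 1)/2 this gives ĥ(S) ∈ 2^{-d} ℤ, whence
-- f̂(S) = 2 ĥ(S) − [S = ∅] lies in 2^{-(d-1)} ℤ.
module Submission where

open import Defs
open import Data.Nat using (ℕ; zero; suc; _^_; _≤_; _+_; s≤s; NonZero)
import Data.Nat.Properties as ℕ
open import Data.Bool using (Bool; true; false; if_then_else_; _xor_; _∧_; not)
open import Data.Bool.Properties using (∧-distribʳ-xor; xor-∧-commutativeRing; if-float)
open import Data.Integer as ℤ using (ℤ; +_; -_; 0ℤ)
import Data.Integer.Properties as ℤ
open import Data.Integer.Divisibility.Signed
  using (_∣_; divides; ∣m∣n⇒∣m+n; ∣m∣n⇒∣m-n; ∣n⇒∣m*n; *-monoʳ-∣)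
open import Data.Integer.Tactic.RingSolver using (solve-∀)
open import Data.Vec using ([]; _∷_; zipWith)
open import Data.List using (List; map; _++_)
import Data.List.Properties as List
open import Data.Product using (_,_)
open import Data.Empty using (⊥-elim)
open import Function using (_∘_)
open import Relation.Binary.PropositionalEquality
import Data.Rational as ℚ
import Data.Rational.Properties as ℚ
open import Data.Rational.Unnormalised using (mkℚᵘ; *≡*) renaming (_*_ to _*ᵘ_)
import Data.Rational.Unnormalised.Properties as ℚᵘ
open import Algebra.Bundles using (CommutativeRing)
import Algebra.Properties.CommutativeSemigroup as CommutativeSemigroupProperties

module ℤ+ = CommutativeSemigroupProperties ℤ.+-commutativeSemigroup
module Xor = CommutativeSemigroupProperties
  (CommutativeRing.+-commutativeSemigroup xor-∧-commutativeRing)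

∑ : ∀ n → (Cube n → ℤ) → ℤ
∑ zero    F = F []
∑ (suc n) F = ∑ n (F ∘ (false ∷_)) ℤ.+ ∑ n (F ∘ (true ∷_))

sumℤ-++ : ∀ (xs ys : List ℤ) → sumℤ (xs ++ ys) ≡ sumℤ xs ℤ.+ sumℤ ys
sumℤ-++ List.[]       ys = sym (ℤ.+-identityˡ (sumℤ ys))
sumℤ-++ (x List.∷ xs) ys = trans (cong (ℤ._+_ x) (sumℤ-++ xs ys)) (sym (ℤ.+-assoc x _ _))

sumℤ-allCube : ∀ n (F : Cube n → ℤ) → sumℤ (map F (allCube n)) ≡ ∑ n F
sumℤ-allCube zero    F = ℤ.+-identityʳ (F [])
sumℤ-allCube (suc n) F = begin
    sumℤ (map F (map (false ∷_) A ++ map (true ∷_) A))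
  ≡⟨ cong sumℤ (List.map-++ F (map (false ∷_) A) _) ⟩
    sumℤ (map F (map (false ∷_) A) ++ map F (map (true ∷_) A))
  ≡⟨ sumℤ-++ (map F (map (false ∷_) A)) _ ⟩
    sumℤ (map F (map (false ∷_) A)) ℤ.+ sumℤ (map F (map (true ∷_) A))
  ≡⟨ cong₂ ℤ._+_ (half (false ∷_)) (half (true ∷_)) ⟩
    ∑ (suc n) F ∎
  where
  open ≡-Reasoning
  A = allCube n
  half : ∀ g → sumℤ (map F (map g A)) ≡ ∑ n (F ∘ g)
  half g = trans (cong sumℤ (sym (List.map-∘ A))) (sumℤ-allCube n (F ∘ g))

∑-cong : ∀ n {F G : Cube n → ℤ} → (∀ x → F x ≡ G x) → ∑ n F ≡ ∑ n G
∑-cong zero    F≗G = F≗G []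
∑-cong (suc n) F≗G = cong₂ ℤ._+_ (∑-cong n (F≗G ∘ (false ∷_))) (∑-cong n (F≗G ∘ (true ∷_)))

∑-+ : ∀ n (F G : Cube n → ℤ) → ∑ n (λ x → F x ℤ.+ G x) ≡ ∑ n F ℤ.+ ∑ n G
∑-+ zero    F G = refl
∑-+ (suc n) F G = trans (cong₂ ℤ._+_ (∑-+ n F₀ G₀) (∑-+ n F₁ G₁))
                        (ℤ+.interchange (∑ n F₀) (∑ n G₀) (∑ n F₁) (∑ n G₁))
  where
  F₀ F₁ G₀ G₁ : Cube n → ℤ
  F₀ = F ∘ (false ∷_)
  F₁ = F ∘ (true ∷_)
  G₀ = G ∘ (false ∷_)
  G₁ = G ∘ (true ∷_)

∑-*ˡ : ∀ n c (F : Cube n → ℤ) → ∑ n (λ x → c ℤ.* F x) ≡ c ℤ.* ∑ n F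
∑-*ˡ zero    c F = refl
∑-*ˡ (suc n) c F = trans
  (cong₂ ℤ._+_ (∑-*ˡ n c (F ∘ (false ∷_))) (∑-*ˡ n c (F ∘ (true ∷_))))
  (sym (ℤ.*-distribˡ-+ c _ _))

∑-neg : ∀ n (F : Cube n → ℤ) → ∑ n (λ x → - F x) ≡ - ∑ n F
∑-neg n F = begin
  ∑ n (λ x → - F x)            ≡⟨ ∑-cong n (λ x → sym (ℤ.-1*i≡-i (F x))) ⟩
  ∑ n (λ x → - ℤ.+ 1 ℤ.* F x)  ≡⟨ ∑-*ˡ n (- ℤ.+ 1) F ⟩
  - ℤ.+ 1 ℤ.* ∑ n F            ≡⟨ ℤ.-1*i≡-i (∑ n F) ⟩
  - ∑ n F                      ∎
  where open ≡-Reasoning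

∑-- : ∀ n (F G : Cube n → ℤ) → ∑ n (λ x → F x ℤ.- G x) ≡ ∑ n F ℤ.- ∑ n G
∑-- n F G = trans (∑-+ n F (λ x → - G x)) (cong (ℤ._+_ (∑ n F)) (∑-neg n G))

sgn : Bool → ℤ
sgn b = if b then - + 1 else + 1

sgn-xor : ∀ p q → sgn (p xor q) ≡ sgn p ℤ.* sgn q
sgn-xor false false = refl
sgn-xor false true  = refl
sgn-xor true  false = refl
sgn-xor true  true  = refl

sgn-not : ∀ p → sgn (not p) ≡ - sgn p
sgn-not false = refl
sgn-not true  = refl

_△_ : ∀ {n} → SubsetN n → SubsetN n → SubsetN n
_△_ = zipWith _xor_

parity-△ : ∀ {n} (R S : SubsetN n) x → parity (R △ S) x ≡ parity R x xor parity S x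
parity-△ []      []      []      = refl
parity-△ (r ∷ R) (s ∷ S) (b ∷ x) = begin
    ((r xor s) ∧ b) xor parity (R △ S) x
  ≡⟨ cong₂ _xor_ (∧-distribʳ-xor b r s) (parity-△ R S x) ⟩
    ((r ∧ b) xor (s ∧ b)) xor (parity R x xor parity S x)
  ≡⟨ Xor.interchange (r ∧ b) (s ∧ b) (parity R x) (parity S x) ⟩
    ((r ∧ b) xor parity R x) xor ((s ∧ b) xor parity S x)
  ∎
  where open ≡-Reasoning

χ-△ : ∀ {n} (R S : SubsetN n) x → χ (R △ S) x ≡ χ R x ℤ.* χ S x
χ-△ R S x = trans (cong sgn (parity-△ R S x)) (sgn-xor (parity R x) (parity S x))

2^[1+k]≡2*2^k : ∀ k → + (2 ^ suc k) ≡ + 2 ℤ.* + (2 ^ k)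
2^[1+k]≡2*2^k k = ℤ.pos-* 2 (2 ^ k)

2^[1+k]*a≡2^k*[2*a] : ∀ k a → + (2 ^ suc k) ℤ.* a ≡ + (2 ^ k) ℤ.* (+ 2 ℤ.* a)
2^[1+k]*a≡2^k*[2*a] k a =
  trans (cong (ℤ._* a) (2^[1+k]≡2*2^k k)) (reassociate (+ (2 ^ k)) a)
  where
  reassociate : ∀ c a → (+ 2 ℤ.* c) ℤ.* a ≡ c ℤ.* (+ 2 ℤ.* a)
  reassociate = solve-∀

2^n∣∑χ : ∀ n (S : SubsetN n) → + (2 ^ n) ∣ ∑ n (χ S)
2^n∣∑χ zero    []          = divides (+ 1) refl
2^n∣∑χ (suc n) (false ∷ S) =
  subst₂ _∣_ (sym (2^[1+k]≡2*2^k n)) (double (∑ n (χ S))) (*-monoʳ-∣ (+ 2) (2^n∣∑χ n S))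
  where
  double : ∀ a → + 2 ℤ.* a ≡ a ℤ.+ a
  double = solve-∀
2^n∣∑χ (suc n) (true ∷ S)  = subst (+ (2 ^ suc n) ∣_) (sym cancels) (divides 0ℤ refl)
  where
  cancels : ∑ n (χ S) ℤ.+ ∑ n (λ x → sgn (not (parity S x))) ≡ 0ℤ
  cancels = begin
      ∑ n (χ S) ℤ.+ ∑ n (λ x → sgn (not (parity S x)))
    ≡⟨ cong (ℤ._+_ (∑ n (χ S))) (trans (∑-cong n (sgn-not ∘ parity S)) (∑-neg n (χ S))) ⟩
      ∑ n (χ S) ℤ.- ∑ n (χ S)
    ≡⟨ ℤ.+-inverseʳ (∑ n (χ S)) ⟩
      0ℤ
    ∎
    where open ≡-Reasoning

-- corr F S is 2^n F̂(S), so Gran≤ k F says that every 2^k F̂(S) is an integer.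
corr : ∀ {n} → (Cube n → ℤ) → SubsetN n → ℤ
corr {n} F S = ∑ n (λ x → F x ℤ.* χ S x)

record Gran≤ {n} (k : ℕ) (F : Cube n → ℤ) : Set where
  constructor gran≤
  field divisible : ∀ S → + (2 ^ n) ∣ + (2 ^ k) ℤ.* corr F S
open Gran≤

module _ {n : ℕ} where

  corr-*ˡ : ∀ c (F : Cube n → ℤ) S → corr (λ x → c ℤ.* F x) S ≡ c ℤ.* corr F S
  corr-*ˡ c F S = trans (∑-cong n (λ x → ℤ.*-assoc c (F x) (χ S x))) (∑-*ˡ n c _)

  corr-- : ∀ (F G : Cube n → ℤ) S →
           corr (λ x → F x ℤ.- G x) S ≡ corr F S ℤ.- corr G S
  corr-- F G S = trans (∑-cong n (λ x → distrib (F x) (G x) (χ S x))) (∑-- n _ _)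
    where
    distrib : ∀ a b c → (a ℤ.- b) ℤ.* c ≡ a ℤ.* c ℤ.- b ℤ.* c
    distrib = solve-∀

  corr-select : ∀ R (F G : Cube n → ℤ) S →
    + 2 ℤ.* corr (λ x → if parity R x then G x else F x) S
      ≡ (corr F S ℤ.+ corr G S) ℤ.+ corr (λ x → F x ℤ.- G x) (R △ S)
  corr-select R F G S = begin
      + 2 ℤ.* corr H S
    ≡⟨ ∑-*ˡ n (+ 2) _ ⟨
      ∑ n (λ x → + 2 ℤ.* (H x ℤ.* χ S x))
    ≡⟨ ∑-cong n pointwise ⟩
      ∑ n (λ x → (F x ℤ.* χ S x ℤ.+ G x ℤ.* χ S x) ℤ.+ (F x ℤ.- G x) ℤ.* χ (R △ S) x)
    ≡⟨ trans (∑-+ n _ _) (cong (ℤ._+ corr (λ x → F x ℤ.- G x) (R △ S)) (∑-+ n _ _)) ⟩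
      (corr F S ℤ.+ corr G S) ℤ.+ corr (λ x → F x ℤ.- G x) (R △ S)
    ∎
    where
    open ≡-Reasoning
    H : Cube n → ℤ
    H x = if parity R x then G x else F x
    split : ∀ p a b s → + 2 ℤ.* ((if p then b else a) ℤ.* s)
                        ≡ (a ℤ.* s ℤ.+ b ℤ.* s) ℤ.+ (a ℤ.- b) ℤ.* (sgn p ℤ.* s)
    split false a b s = on-zero a b s
      where
      on-zero : ∀ a b s → + 2 ℤ.* (a ℤ.* s) ≡ (a ℤ.* s ℤ.+ b ℤ.* s) ℤ.+ (a ℤ.- b) ℤ.* (+ 1 ℤ.* s)
      on-zero = solve-∀
    split true  a b s = on-one a b s
      where
      on-one : ∀ a b s → + 2 ℤ.* (b ℤ.* s) ≡ (a ℤ.* s ℤ.+ b ℤ.* s) ℤ.+ (a ℤ.- b) ℤ.* (- + 1 ℤ.* s)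
      on-one = solve-∀
    pointwise : ∀ x → + 2 ℤ.* (H x ℤ.* χ S x)
                      ≡ (F x ℤ.* χ S x ℤ.+ G x ℤ.* χ S x) ℤ.+ (F x ℤ.- G x) ℤ.* χ (R △ S) x
    pointwise x = trans (split (parity R x) (F x) (G x) (χ S x))
                        (cong (λ c → (F x ℤ.* χ S x ℤ.+ G x ℤ.* χ S x) ℤ.+ (F x ℤ.- G x) ℤ.* c)
                              (sym (χ-△ R S x)))

  Gran≤-cong : ∀ {k} {F G : Cube n → ℤ} → (∀ x → F x ≡ G x) → Gran≤ k F → Gran≤ k G
  Gran≤-cong {k} F≗G gran = gran≤ λ S →
    subst (λ c → + (2 ^ n) ∣ + (2 ^ k) ℤ.* c) (∑-cong n (λ x → cong (ℤ._* χ S x) (F≗G x)))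
      (divisible gran S)

  Gran≤-const : ∀ k c → Gran≤ k (λ _ → c)
  Gran≤-const k c = gran≤ λ S → ∣n⇒∣m*n (+ (2 ^ k))
    (subst (+ (2 ^ n) ∣_) (sym (∑-*ˡ n c (χ S))) (∣n⇒∣m*n c (2^n∣∑χ n S)))

  Gran≤-- : ∀ {k} {F G : Cube n → ℤ} → Gran≤ k F → Gran≤ k G → Gran≤ k (λ x → F x ℤ.- G x)
  Gran≤-- {k} {F} {G} granF granG = gran≤ λ S →
    subst (+ (2 ^ n) ∣_) (sym (distrib S)) (∣m∣n⇒∣m-n (divisible granF S) (divisible granG S))
    where
    *-distribˡ-- : ∀ c a b → c ℤ.* (a ℤ.- b) ≡ c ℤ.* a ℤ.- c ℤ.* b
    *-distribˡ-- = solve-∀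
    distrib : ∀ S → + (2 ^ k) ℤ.* corr (λ x → F x ℤ.- G x) S
                    ≡ + (2 ^ k) ℤ.* corr F S ℤ.- + (2 ^ k) ℤ.* corr G S
    distrib S = trans (cong (ℤ._*_ (+ (2 ^ k))) (corr-- F G S))
                      (*-distribˡ-- (+ (2 ^ k)) (corr F S) (corr G S))

  Gran≤-double : ∀ {k} {F : Cube n → ℤ} → Gran≤ (suc k) F → Gran≤ k (λ x → + 2 ℤ.* F x)
  Gran≤-double {k} {F} gran = gran≤ λ S → subst (+ (2 ^ n) ∣_) (sym (eq S)) (divisible gran S)
    where
    eq : ∀ S → + (2 ^ k) ℤ.* corr (λ x → + 2 ℤ.* F x) S ≡ + (2 ^ suc k) ℤ.* corr F S
    eq S = trans (cong (ℤ._*_ (+ (2 ^ k))) (corr-*ˡ (+ 2) F S)) (sym (2^[1+k]*a≡2^k*[2*a] k _))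

  Gran≤-select : ∀ {k} R {F G : Cube n → ℤ} → Gran≤ k F → Gran≤ k G →
                 Gran≤ (suc k) (λ x → if parity R x then G x else F x)
  Gran≤-select {k} R {F} {G} granF granG = gran≤ λ S →
    subst (+ (2 ^ n) ∣_) (sym (eq S))
      (∣m∣n⇒∣m+n (∣m∣n⇒∣m+n (divisible granF S) (divisible granG S))
                 (divisible (Gran≤-- granF granG) (R △ S)))
    where
    open ≡-Reasoning
    distrib : ∀ c a b d → c ℤ.* ((a ℤ.+ b) ℤ.+ d) ≡ (c ℤ.* a ℤ.+ c ℤ.* b) ℤ.+ c ℤ.* d
    distrib = solve-∀
    eq : ∀ S → + (2 ^ suc k) ℤ.* corr (λ x → if parity R x then G x else F x) S
               ≡ (+ (2 ^ k) ℤ.* corr F S ℤ.+ + (2 ^ k) ℤ.* corr G S)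
                 ℤ.+ + (2 ^ k) ℤ.* corr (λ x → F x ℤ.- G x) (R △ S)
    eq S = begin
        + (2 ^ suc k) ℤ.* corr (λ x → if parity R x then G x else F x) S
      ≡⟨ 2^[1+k]*a≡2^k*[2*a] k _ ⟩
        + (2 ^ k) ℤ.* (+ 2 ℤ.* corr (λ x → if parity R x then G x else F x) S)
      ≡⟨ cong (ℤ._*_ (+ (2 ^ k))) (corr-select R F G S) ⟩
        + (2 ^ k) ℤ.* ((corr F S ℤ.+ corr G S) ℤ.+ corr (λ x → F x ℤ.- G x) (R △ S))
      ≡⟨ distrib (+ (2 ^ k)) (corr F S) (corr G S) (corr (λ x → F x ℤ.- G x) (R △ S)) ⟩
        (+ (2 ^ k) ℤ.* corr F S ℤ.+ + (2 ^ k) ℤ.* corr G S)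
          ℤ.+ + (2 ^ k) ℤ.* corr (λ x → F x ℤ.- G x) (R △ S)
      ∎

PDT-Gran≤ : ∀ {n} (v : PM → ℤ) (T : PDT n) {k} → depth T ≤ k → Gran≤ k (v ∘ evalPDT T)
PDT-Gran≤ v (leaf b)       {k}     _         = Gran≤-const k (v b)
PDT-Gran≤ v (node R t₀ t₁) {suc k} (s≤s d≤k) =
  Gran≤-cong (λ x → sym (if-float v (parity R x)))
    (Gran≤-select R (PDT-Gran≤ v t₀ (ℕ.m⊔n≤o⇒m≤o (depth t₀) _ d≤k))
                    (PDT-Gran≤ v t₁ (ℕ.m⊔n≤o⇒n≤o _ (depth t₁) d≤k)))

bit : PM → ℤ
bit minusOne = + 0
bit plusOne  = + 1

PMtoℤ≡2*bit-1 : ∀ b → PMtoℤ b ≡ + 2 ℤ.* bit b ℤ.- + 1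
PMtoℤ≡2*bit-1 minusOne = refl
PMtoℤ≡2*bit-1 plusOne  = refl

PDT-±1-Gran≤ : ∀ {n} (T : PDT n) {k} → depth T ≤ suc k → Gran≤ k (PMtoℤ ∘ evalPDT T)
PDT-±1-Gran≤ T {k} d≤1+k =
  Gran≤-cong (sym ∘ PMtoℤ≡2*bit-1 ∘ evalPDT T)
    (Gran≤-- (Gran≤-double (PDT-Gran≤ bit T d≤1+k)) (Gran≤-const k (+ 1)))

a/1*N/d≡z/1 : ∀ a N z d .{{_ : NonZero d}} → a ℤ.* N ≡ z ℤ.* + d →
              (a ℚ./ 1) ℚ.* (N ℚ./ d) ≡ z ℚ./ 1
a/1*N/d≡z/1 a N z (suc m) aN≡zd = ℚ.toℚᵘ-injective (begin
    ℚ.toℚᵘ ((a ℚ./ 1) ℚ.* (N ℚ./ suc m))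
  ≈⟨ ℚ.toℚᵘ-homo-* (a ℚ./ 1) (N ℚ./ suc m) ⟩
    ℚ.toℚᵘ (a ℚ./ 1) *ᵘ ℚ.toℚᵘ (N ℚ./ suc m)
  ≈⟨ ℚᵘ.*-cong (ℚ.toℚᵘ-fromℚᵘ (mkℚᵘ a 0)) (ℚ.toℚᵘ-fromℚᵘ (mkℚᵘ N m)) ⟩
    mkℚᵘ a 0 *ᵘ mkℚᵘ N m
  ≈⟨ *≡* (trans (ℤ.*-identityʳ (a ℤ.* N))
                (trans aN≡zd (cong (ℤ._*_ z) (sym (ℤ.*-identityˡ (+ suc m)))))) ⟩
    mkℚᵘ z 0
  ≈⟨ ℚ.toℚᵘ-fromℚᵘ (mkℚᵘ z 0) ⟨
    ℚ.toℚᵘ (z ℚ./ 1)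
  ∎)
  where open ℚᵘ.≃-Reasoning

Gran≤⇒2^k*fourier-integral : ∀ {n k} (f : Cube n → PM) → Gran≤ k (PMtoℤ ∘ f) →
                              ∀ S → IsInteger ((+ (2 ^ k) ℚ./ 1) ℚ.* fourier f S)
Gran≤⇒2^k*fourier-integral {n} {k} f gran S with divisible gran S
... | divides q 2^k*corr≡q*2^n =
  q , a/1*N/d≡z/1 (+ (2 ^ k)) _ q (2 ^ n) {{ℕ.m^n≢0 2 n}}
        (trans (cong (ℤ._*_ (+ (2 ^ k))) (sumℤ-allCube n _)) 2^k*corr≡q*2^n)

IsGran⇒≤ : ∀ {α k j} → IsGran α k → IsInteger ((+ (2 ^ j) ℚ./ 1) ℚ.* α) → k ≤ j
IsGran⇒≤ {j = j} (_ , minimal) integral = ℕ.≮⇒≥ (λ j<k → minimal j j<k integral)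

depth≡0⇒constant : ∀ {n} (T : PDT n) {f : Cube n → PM} → Computes T f → depth T ≡ 0 →
                   ∀ x y → f x ≡ f y
depth≡0⇒constant (leaf b) T-computes-f _ x y = trans (sym (T-computes-f x)) (T-computes-f y)

theorem6 : (n : ℕ) → 1 ≤ n → (f : Cube n → PM) → NonConstant f →
    (d g : ℕ) → IsDPar f d → IsGranF f g → g + 1 ≤ d
theorem6 n _ f (x , y , fx≢fy) zero g ((T , T-computes-f , depthT≡0) , _) _ =
  ⊥-elim (fx≢fy (depth≡0⇒constant T T-computes-f depthT≡0 x y))
theorem6 n _ f _ (suc d) g ((T , T-computes-f , depthT≡1+d) , _) ((S , granS) , _) =
  ℕ.≤-trans (ℕ.≤-reflexive (ℕ.+-comm g 1))
            (s≤s (IsGran⇒≤ granS (Gran≤⇒2^k*fourier-integral f gran S)))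
  where
  gran : Gran≤ d (PMtoℤ ∘ f)
  gran = Gran≤-cong (cong PMtoℤ ∘ T-computes-f) (PDT-±1-Gran≤ T (ℕ.≤-reflexive depthT≡1+d))
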